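{- Let $n\ge1$ and $m>2^n$ be integers, and consider a play of the game described in the context in which Kronecker uses the ``0 first'' strategy and Cantor's (adaptive) strategy is arbitrary; let $L_t$ be the state matrix after $t$ queries. Suppose that row $L_t(i)$ is not essential for $L_t$, that $L_t(i,j)=\star$, and that entry $(i,j)$ is queried at step $t+1$. Then $L_{t+1}(i,j)=0$.
   Context: Kronecker holds $v_1,\ldots,v_m\in\{0,1\}^n$; Cantor queries entries ``bit $j$ of vector $i$''. The state is an $m\times n$ matrix $L$ over $\{0,1,\star\}$, where $L(i,j)=\star$ means bit $j$ of $v_i$ is not yet queried and otherwise it is Kronecker's answer; $L_0$ is all $\star$, each query is to a $\star$ entry, and $L(i)$ denotes row $i$. A set $S$ of $2^n$ rows of $L$ is useful if, after replacing each $\star$ in $S$ by $0$ or $1$ suitably, the rows of $S$ are exactly the $2^n$ distinct vectors of $\{0,1\}^n$. $L$ is unblocked if it has a useful set of rows, and blocked otherwise. For an unblocked $L$, row $L(i)$ is essential for $L$ if every useful set of rows of $L$ contains $L(i)$. The ``0 first'' strategy: when entry $(i,j)$ is queried, Kronecker answers $1$ if setting $L(i,j)$ to $0$ would make $L$ blocked, and $0$ otherwise. -}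

module Defs where

open import Data.Nat using (ℕ; _^_)
open import Data.Bool using (Bool; true; false)
open import Data.Fin using (Fin; _≟_)
open import Data.Fin.Subset using (Subset; _∈_; _∉_; ∣_∣)
open import Data.Product using (Σ; ∃; _×_; _,_)
open import Data.Sum using (_⊎_)
open import Relation.Nullary using (¬_; yes; no)
open import Relation.Binary.PropositionalEquality using (_≡_)

-- An entry of the state matrix: ⋆ (not yet queried) or a queried bit.
data Entry : Set where
  ⋆   : Entry
  bit : Bool → Entry

State : ℕ → ℕ → Set
State m n = Fin m → Fin n → Entry

L₀ : ∀ {m n} → State m n
L₀ i j = ⋆

update : ∀ {m n} → State m n → Fin m → Fin n → Entry → State m n
update L i j e i' j' with i' ≟ i | j' ≟ j
... | yes _ | yes _ = e
... | _     | _     = L i' j'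

Completes : Entry → Bool → Set
Completes e b = (e ≡ ⋆) ⊎ (e ≡ bit b)

Useful : ∀ {m n} → State m n → Subset m → Set
Useful {m} {n} L S =
  (∣ S ∣ ≡ 2 ^ n) ×
  Σ (Fin m → Fin n → Bool) λ c →
    (∀ i → i ∈ S → ∀ j → Completes (L i j) (c i j)) ×
    (∀ i i' → i ∈ S → i' ∈ S → (∀ j → c i j ≡ c i' j) → i ≡ i') ×
    (∀ (v : Fin n → Bool) → ∃ λ i → i ∈ S × (∀ j → c i j ≡ v j))

Unblocked : ∀ {m n} → State m n → Set
Unblocked {m} L = ∃ λ (S : Subset m) → Useful L S

Blocked : ∀ {m n} → State m n → Set
Blocked L = ¬ Unblocked L

Essential : ∀ {m n} → State m n → Fin m → Set
Essential {m} L i = ∀ (S : Subset m) → Useful L S → i ∈ S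

ZeroFirstAnswer : ∀ {m n} → State m n → Fin m → Fin n → Bool → Set
ZeroFirstAnswer L i j b =
  ((b ≡ true)  × Blocked (update L i j (bit false))) ⊎
  ((b ≡ false) × ¬ Blocked (update L i j (bit false)))

Step : ∀ {m n} → State m n → Fin m → Fin n → State m n → Set
Step L i j L' =
  (L i j ≡ ⋆) × ∃ λ b → ZeroFirstAnswer L i j b × (L' ≡ update L i j (bit b))

-- States reachable from L₀ by some play in which Kronecker uses the
-- "0 first" strategy and Cantor queries arbitrarily (adaptively).
data Reachable {m n : ℕ} : State m n → Set where
  start : Reachable L₀
  step  : ∀ {L L'} (i : Fin m) (j : Fin n) →
          Reachable L → Step L i j L' → Reachable L'

{-# OPTIONS --safe #-}
module Submission where

-- Changing entries of a row outside a useful set S leaves S useful. So if row i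
-- is not essential, some useful set avoids it, and that set stays useful after
-- L(i,j) is set to 0: the state stays unblocked and Kronecker answers 0.

open import Defs
open import Data.Nat using (ℕ; _^_; _≤_; _<_)
open import Data.Fin using (Fin; _≟_)
open import Data.Bool using (false)
open import Data.Fin.Subset using (Subset; _∈_; _∉_)
open import Data.Fin.Subset.Properties using (_∈?_)
open import Data.Product using (_,_)
open import Data.Sum using (inj₁; inj₂)
open import Data.Empty using (⊥-elim)
open import Relation.Nullary using (¬_; yes; no)
open import Relation.Binary.PropositionalEquality using (_≡_; refl; sym; subst)

update-≢ : ∀ {m n} (L : State m n) {i i′ : Fin m} (j j′ : Fin n) (e : Entry) →
           ¬ i′ ≡ i → update L i j e i′ j′ ≡ L i′ j′
update-≢ L {i} {i′} j j′ e i′≢i with i′ ≟ i | j′ ≟ j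
... | yes i′≡i | yes _ = ⊥-elim (i′≢i i′≡i)
... | yes _    | no _  = refl
... | no _     | _     = refl

update-≡ : ∀ {m n} (L : State m n) (i : Fin m) (j : Fin n) (e : Entry) →
           update L i j e i j ≡ e
update-≡ L i j e with i ≟ i | j ≟ j
... | yes _   | yes _   = refl
... | no i≢i  | _       = ⊥-elim (i≢i refl)
... | yes _   | no j≢j  = ⊥-elim (j≢j refl)

Useful-resp-rows : ∀ {m n} {L L′ : State m n} {S : Subset m} →
                   (∀ i → i ∈ S → ∀ j → L i j ≡ L′ i j) →
                   Useful L S → Useful L′ S
Useful-resp-rows L≡L′ (size , c , completes , distinct , covers) =
  size
  , c
  , (λ i i∈S j → subst (λ e → Completes e (c i j)) (L≡L′ i i∈S j) (completes i i∈S j))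
  , distinct
  , covers

Useful-update-∉ : ∀ {m n} (L : State m n) {i : Fin m} (j : Fin n) (e : Entry) {S : Subset m} →
                  i ∉ S → Useful L S → Useful (update L i j e) S
Useful-update-∉ L j e i∉S =
  Useful-resp-rows λ i′ i′∈S j′ → sym (update-≢ L j j′ e λ { refl → i∉S i′∈S })

blocked-update⇒essential : ∀ {m n} (L : State m n) (i : Fin m) (j : Fin n) (e : Entry) →
                           Blocked (update L i j e) → Essential L i
blocked-update⇒essential L i j e blocked S useful with i ∈? S
... | yes i∈S = i∈S
... | no i∉S  = ⊥-elim (blocked (S , Useful-update-∉ L j e i∉S useful))

lemma4p8 : (n m : ℕ) → 1 ≤ n → 2 ^ n < m →
           (Lt Lt₁ : State m n) → Reachable Lt →
           (i : Fin m) (j : Fin n) →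
           ¬ Essential Lt i → Lt i j ≡ ⋆ → Step Lt i j Lt₁ →
           Lt₁ i j ≡ bit false
lemma4p8 n m _ _ Lt Lt₁ _ i j ¬essential _ (_ , _ , inj₁ (_ , blocked) , _) =
  ⊥-elim (¬essential (blocked-update⇒essential Lt i j (bit false) blocked))
lemma4p8 n m _ _ Lt Lt₁ _ i j _ _ (_ , _ , inj₂ (refl , _) , refl) =
  update-≡ Lt i j (bit false)
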